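{- Let $k\ge 3$ and let $(V,\mathcal{B})$ be a $\mathrm{DCCD}(v,k,b)$ (strength $2$) which has an expansion set, where $v$ is an odd multiple of $k-2$. Then there exists a $\mathrm{DCCD}(v^*,k,b^*)$ $(V^*,\mathcal{B}^*)$ with $$v^*=v+\frac{v}{k-2}+1,\qquad b^*=b+\frac{v}{k-2}\cdot\frac{v+k-2}{2k-4}.$$ Moreover, if $(V,\mathcal{B})$ is tight, economical or circular, then $(V^*,\mathcal{B}^*)$ is also tight, economical or circular, respectively.
   Context: A double change covering design $\mathrm{DCCD}(v,k,b)$ (of strength 2) is a pair $(V,\mathcal{B})$ where $V$ is a $v$-set and $\mathcal{B}=(B_1,\dots,B_b)$ is an ordered list of $k$-subsets of $V$ (blocks) such that every 2-subset of $V$ lies in at least one block and $|B_i\setminus B_{i+1}|=|B_{i+1}\setminus B_i|=2$ for $1\le i<b$. It is circular ($\mathrm{CDCCD}(v,k,b)$) if also $|B_b\setminus B_1|=|B_1\setminus B_b|=2$. Unchanged subsets: $U_i=B_i\cap B_{i+1}$ for $1\le i\le b-1$ (each of size $k-2$). For a linear design, $U_0$ may be taken to be any $(k-2)$-subset of $B_1$ and $U_b$ any $(k-2)$-subset of $B_b$; for a circular design $U_0=U_b=B_1\cap B_b$. The design has an expansion set if there are indices $i_1<\dots<i_l$ in $\{0,\dots,b\}$ (with admissible choices of $U_0,U_b$ in the linear case) such that $U_{i_1},\dots,U_{i_l}$ partition $V$. Let $g_1(v,k)=\lceil(\binom v2-\binom k2)/(2k-3)\rceil+1$ and $g_2(v,k)=\lceil\binom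 v2/(2k-3)\rceil$. A linear DCCD is economical if $b=g_1(v,k)$ and tight if it is economical and $(\binom v2-\binom k2)/(2k-3)$ is an integer; a circular DCCD is economical if $b=g_2(v,k)$ and tight if it is economical and $\binom v2/(2k-3)$ is an integer. -}

module Defs where

open import Data.Nat using (ℕ; zero; suc; _+_; _*_; _∸_; _<_; _≤_; _<?_; _≟_)
open import Data.Nat.DivMod using (_/_)
open import Data.Nat.Divisibility using (_∣_)
open import Data.Nat.Combinatorics using (_C_)
open import Data.Fin using (Fin; toℕ; fromℕ<)
open import Data.Fin.Subset using (Subset; _∈_; _⊆_; _∩_; _─_; ∣_∣; ⊥)
open import Data.Product using (Σ; ∃; _×_)
open import Relation.Binary.PropositionalEquality using (_≡_; _≢_)
open import Relation.Nullary using (yes; no)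

-- A list of b blocks on the point set V = Fin v: B₁,…,B_b is B 0,…,B (b-1).
Blocks : ℕ → ℕ → Set
Blocks v b = Fin b → Subset v

-- Block with 0-based ℕ index (empty set out of range; only used in range).
blk : ∀ {v b} → Blocks v b → ℕ → Subset v
blk {b = b} B i with i <? b
... | yes p = B (fromℕ< p)
... | no _  = ⊥

DoubleChange : ∀ {v} → Subset v → Subset v → Set
DoubleChange X Y = (∣ X ─ Y ∣ ≡ 2) × (∣ Y ─ X ∣ ≡ 2)

record IsDCCD (v k b : ℕ) (B : Blocks v b) : Set where
  field
    blockSize : ∀ (i : Fin b) → ∣ B i ∣ ≡ k
    covering  : ∀ (x y : Fin v) → x ≢ y → ∃ λ (i : Fin b) → (x ∈ B i) × (y ∈ B i)
    change    : ∀ (i j : Fin b) → suc (toℕ i) ≡ toℕ j → DoubleChange (B i) (B j)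

record IsCDCCD (v k b : ℕ) (B : Blocks v b) : Set where
  field
    isDCCD   : IsDCCD v k b B
    circular : ∀ (f l : Fin b) → toℕ f ≡ 0 → suc (toℕ l) ≡ b → DoubleChange (B l) (B f)

-- Unchanged subsets U_0,…,U_b (indexed by Fin (suc b)), given the choice of U_0, U_b.
-- For 1 ≤ i ≤ b-1: U_i = B_i ∩ B_{i+1} = blk (i-1) ∩ blk i (0-based blocks).
Ufam : ∀ {v b} → Blocks v b → Subset v → Subset v → Fin (suc b) → Subset v
Ufam {b = b} B U0 Ub i with toℕ i ≟ 0
... | yes _ = U0
... | no _ with toℕ i ≟ b
...   | yes _ = Ub
...   | no _  = blk B (toℕ i ∸ 1) ∩ blk B (toℕ i)

PartitionedBy : ∀ {v b} → (Fin (suc b) → Subset v) → Subset (suc b) → Set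
PartitionedBy {v} {b} U S =
  (∀ (x : Fin v) → ∃ λ (i : Fin (suc b)) → (i ∈ S) × (x ∈ U i)) ×
  (∀ (x : Fin v) (i j : Fin (suc b)) → i ∈ S → j ∈ S → x ∈ U i → x ∈ U j → i ≡ j)

HasExpansionSet : (v k b : ℕ) → Blocks v b → Set
HasExpansionSet v k b B =
  Σ (Subset v) λ U0 → Σ (Subset v) λ Ub →
  (∃ λ (f : Fin b) → (toℕ f ≡ 0) × (U0 ⊆ B f) × (∣ U0 ∣ ≡ k ∸ 2)) ×
  (∃ λ (l : Fin b) → (suc (toℕ l) ≡ b) × (Ub ⊆ B l) × (∣ Ub ∣ ≡ k ∸ 2)) ×
  (∃ λ (S : Subset (suc b)) → PartitionedBy (Ufam B U0 Ub) S)

HasCircExpansionSet : (v k b : ℕ) → Blocks v b → Set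
HasCircExpansionSet v k b B =
  ∃ λ (f : Fin b) → ∃ λ (l : Fin b) → (toℕ f ≡ 0) × (suc (toℕ l) ≡ b) ×
  (∃ λ (S : Subset (suc b)) →
     PartitionedBy (Ufam B (B f ∩ B l) (B f ∩ B l)) S)

-- ⌈a / d⌉ for d > 0 (value 0 for d = 0, never used)
ceilDiv : ℕ → ℕ → ℕ
ceilDiv a zero    = 0
ceilDiv a (suc d) = (a + d) / suc d

g₁ : ℕ → ℕ → ℕ
g₁ v k = suc (ceilDiv (v C 2 ∸ k C 2) (2 * k ∸ 3))

g₂ : ℕ → ℕ → ℕ
g₂ v k = ceilDiv (v C 2) (2 * k ∸ 3)

EconomicalLin : ℕ → ℕ → ℕ → Set
EconomicalLin v k b = b ≡ g₁ v k

TightLin : ℕ → ℕ → ℕ → Set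
TightLin v k b = EconomicalLin v k b × ((2 * k ∸ 3) ∣ (v C 2 ∸ k C 2))

EconomicalCirc : ℕ → ℕ → ℕ → Set
EconomicalCirc v k b = b ≡ g₂ v k

TightCirc : ℕ → ℕ → ℕ → Set
TightCirc v k b = EconomicalCirc v k b × ((2 * k ∸ 3) ∣ (v C 2))

module Submission where

-- Write k = K + 2 and v = m K with m = 2n + 1, and add m + 1 new points.  The unchanged subsets
-- U_p (p ∈ S) of the expansion set partition the old points into K-sets, so there are exactly m
-- of them.  The round-robin one-factorisation of the complete graph on the new points has m
-- factors, each made of n + 1 disjoint pairs.  If U_p is the r-th member of the expansion set, the
-- blocks U_p ∪ e, e running through the r-th factor, are inserted between B_p and B_(p+1).
-- Consecutive inserted blocks differ only in their disjoint pairs and both neighbouring old blocks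
-- contain U_p, so every transition is a double change.  An old point x ∈ U_p meets every new point
-- in the blocks inserted at U_p, since a factor covers all new points, and two new points share a
-- pair of some factor.  The design gains m (n + 1) blocks, and (v + m + 1) C 2 − v C 2 equals
-- (2k − 3) m (n + 1), so g₁ and g₂ grow by m (n + 1) as well, preserving economy and tightness.
-- In the circular case U_0 = U_b, so at most one end of the sequence receives inserted blocks
-- and the closing transition is again a double change.

open import Defs
open import Data.Nat using (ℕ; suc; _+_; _*_; _∸_; _≤_)
open import Data.Nat.DivMod using (_/_; _%_)
open import Data.Product using (Σ; _×_)
open import Relation.Binary.PropositionalEquality using (_≡_)

open import Data.Bool using (Bool; true; false)
open import Data.Empty using (⊥-elim)
open import Data.Fin using (Fin; zero; suc; toℕ; fromℕ; fromℕ<; inject₁; _↑ˡ_; _↑ʳ_; splitAt)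
open import Data.Fin.Properties
  using (toℕ-fromℕ<; toℕ-injective; toℕ<n; toℕ-fromℕ; toℕ-inject₁; fromℕ<-toℕ; toℕ≤pred[n];
         splitAt⁻¹-↑ˡ; splitAt⁻¹-↑ʳ)
import Data.Fin.Properties as Finₚ
open import Data.Fin.Subset using (Subset; _∈_; _∉_; _⊆_; _∩_; _∪_; _─_; ∣_∣; ⊥; ⊤; ⁅_⁆; Empty; Nonempty)
open import Data.Fin.Subset.Properties
  using (Empty-unique; drop-there; nonempty?; p∩q⊆p; p∩q⊆q; p─⊥≡p; x∈p∩q⁺; x∈p∩q⁻; x∈p∪q⁺; x∈p∪q⁻;
         x∈⁅x⁆; x∈⁅y⁆⇒x≡y; ∈⊤; ∉⊥; ∣p∣≡n⇒p≡⊤; ∣p∣≤n; ∣p─q∣≤∣p∣; ∣⁅x⁆∣≡1; ∣⊤∣≡n; ∣⊥∣≡0;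
         ∩-comm; ⊆-antisym; ⊆-refl; ⊆⊤)
open import Data.List using (List; []; _∷_; length; lookup; head; last; map; applyUpTo)
import Data.List as List
open import Data.List.Properties using (length-++; length-map; length-applyUpTo)
open import Data.List.Membership.Propositional using () renaming (_∈_ to _∈ₗ_)
open import Data.List.Membership.Propositional.Properties
  using (∈-++⁺ˡ; ∈-++⁺ʳ; ∈-map⁺; ∈-lookup; ∈-applyUpTo⁺)
open import Data.List.Relation.Unary.All as All using (All; []; _∷_)
import Data.List.Relation.Unary.All.Properties as All
open import Data.List.Relation.Unary.Any using (here; there; index)
open import Data.List.Relation.Unary.Any.Properties using (lookup-index)
open import Data.List.Relation.Unary.Linked as Linked using (Linked; []; _∷_; _∷′_)
import Data.List.Relation.Unary.Linked.Properties as Linked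
open import Data.Maybe using (just)
open import Data.Maybe.Relation.Binary.Connected using (Connected; just; just-nothing; nothing-just)
open import Data.Nat
open import Data.Nat.Properties
open import Data.Nat.DivMod
  using (m≡m%n+[m/n]*n; m%n<n; m%n%n≡m%n; %-distribˡ-+; [m+n]%n≡m%n; m<n⇒m%n≡m; m*n/n≡m; +-distrib-/-∣ʳ)
open import Data.Nat.Divisibility using (_∣_; divides; ∣m+n∣m⇒∣n; ∣m∣n⇒∣m+n; m∣m*n; n∣m*n; ∣⇒≤)
open import Data.Nat.Combinatorics using (_C_; nC1≡n; nCk+nC[k+1]≡[n+1]C[k+1])
open import Data.Nat.Tactic.RingSolver using (solve-∀)
open import Data.Product using (∃; _,_; proj₁; proj₂; map₂)
open import Data.Sum using (_⊎_; inj₁; inj₂)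
open import Data.Vec using ([]; _∷_; _++_; here; there)
import Data.Vec as Vec
open import Data.Vec.Properties using (zipWith-++; []=⇒lookup; lookup⇒[]=)
open import Function using (_∘_)
open import Relation.Binary.Definitions using (tri<; tri≈; tri>)
open import Relation.Binary.PropositionalEquality
open import Relation.Nullary using (¬_; yes; no)

private variable c n : ℕ

-- Cardinalities of finite subsets

∣p++q∣≡∣p∣+∣q∣ : ∀ {m} (p : Subset m) (q : Subset n) → ∣ p ++ q ∣ ≡ ∣ p ∣ + ∣ q ∣
∣p++q∣≡∣p∣+∣q∣ []          q = refl
∣p++q∣≡∣p∣+∣q∣ (true ∷ p)  q = cong suc (∣p++q∣≡∣p∣+∣q∣ p q)
∣p++q∣≡∣p∣+∣q∣ (false ∷ p) q = ∣p++q∣≡∣p∣+∣q∣ p q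

∣p∣≡∣p∩q∣+∣p─q∣ : ∀ (p q : Subset n) → ∣ p ∣ ≡ ∣ p ∩ q ∣ + ∣ p ─ q ∣
∣p∣≡∣p∩q∣+∣p─q∣ []          []          = refl
∣p∣≡∣p∩q∣+∣p─q∣ (true ∷ p)  (true ∷ q)  = cong suc (∣p∣≡∣p∩q∣+∣p─q∣ p q)
∣p∣≡∣p∩q∣+∣p─q∣ (true ∷ p)  (false ∷ q) = trans (cong suc (∣p∣≡∣p∩q∣+∣p─q∣ p q)) (sym (+-suc _ _))
∣p∣≡∣p∩q∣+∣p─q∣ (false ∷ p) (true ∷ q)  = ∣p∣≡∣p∩q∣+∣p─q∣ p q
∣p∣≡∣p∩q∣+∣p─q∣ (false ∷ p) (false ∷ q) = ∣p∣≡∣p∩q∣+∣p─q∣ p q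

∣p∪q∣+∣p∩q∣≡∣p∣+∣q∣ : ∀ (p q : Subset n) → ∣ p ∪ q ∣ + ∣ p ∩ q ∣ ≡ ∣ p ∣ + ∣ q ∣
∣p∪q∣+∣p∩q∣≡∣p∣+∣q∣ []          []          = refl
∣p∪q∣+∣p∩q∣≡∣p∣+∣q∣ (true ∷ p)  (true ∷ q)  =
  cong suc (trans (+-suc _ _) (trans (cong suc (∣p∪q∣+∣p∩q∣≡∣p∣+∣q∣ p q)) (sym (+-suc _ _))))
∣p∪q∣+∣p∩q∣≡∣p∣+∣q∣ (true ∷ p)  (false ∷ q) = cong suc (∣p∪q∣+∣p∩q∣≡∣p∣+∣q∣ p q)
∣p∪q∣+∣p∩q∣≡∣p∣+∣q∣ (false ∷ p) (true ∷ q)  = trans (cong suc (∣p∪q∣+∣p∩q∣≡∣p∣+∣q∣ p q)) (sym (+-suc _ _))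
∣p∪q∣+∣p∩q∣≡∣p∣+∣q∣ (false ∷ p) (false ∷ q) = ∣p∪q∣+∣p∩q∣≡∣p∣+∣q∣ p q

Disjoint : Subset n → Subset n → Set
Disjoint p q = Empty (p ∩ q)

Disjoint-sym : ∀ {p q : Subset n} → Disjoint p q → Disjoint q p
Disjoint-sym {p = p} {q} d (x , x∈q∩p) = d (x , subst (x ∈_) (∩-comm q p) x∈q∩p)

∣p∩q∣≡0 : ∀ {p q : Subset n} → Disjoint p q → ∣ p ∩ q ∣ ≡ 0
∣p∩q∣≡0 {n} d = trans (cong ∣_∣ (Empty-unique d)) (∣⊥∣≡0 n)

disjoint⇒∣p─q∣≡∣p∣ : ∀ {p q : Subset n} → Disjoint p q → ∣ p ─ q ∣ ≡ ∣ p ∣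
disjoint⇒∣p─q∣≡∣p∣ {p = p} {q} d = sym (trans (∣p∣≡∣p∩q∣+∣p─q∣ p q) (cong (_+ ∣ p ─ q ∣) (∣p∩q∣≡0 d)))

disjoint⇒∣p∪q∣≡∣p∣+∣q∣ : ∀ {p q : Subset n} → Disjoint p q → ∣ p ∪ q ∣ ≡ ∣ p ∣ + ∣ q ∣
disjoint⇒∣p∪q∣≡∣p∣+∣q∣ {p = p} {q} d =
  trans (sym (+-identityʳ _)) (trans (cong (∣ p ∪ q ∣ +_) (sym (∣p∩q∣≡0 d))) (∣p∪q∣+∣p∩q∣≡∣p∣+∣q∣ p q))

p⊆q⇒p∩q≡p : ∀ {p q : Subset n} → p ⊆ q → p ∩ q ≡ p
p⊆q⇒p∩q≡p p⊆q = ⊆-antisym (p∩q⊆p _ _) (λ x∈p → x∈p∩q⁺ (x∈p , p⊆q x∈p))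

p⊆q⇒∣p─q∣≡0 : ∀ {p q : Subset n} → p ⊆ q → ∣ p ─ q ∣ ≡ 0
p⊆q⇒∣p─q∣≡0 {p = p} {q} p⊆q = +-cancelˡ-≡ ∣ p ∣ _ _ (begin
  ∣ p ∣ + ∣ p ─ q ∣     ≡⟨ cong (λ r → ∣ r ∣ + ∣ p ─ q ∣) (p⊆q⇒p∩q≡p p⊆q) ⟨
  ∣ p ∩ q ∣ + ∣ p ─ q ∣ ≡⟨ ∣p∣≡∣p∩q∣+∣p─q∣ p q ⟨
  ∣ p ∣                 ≡⟨ +-identityʳ ∣ p ∣ ⟨
  ∣ p ∣ + 0             ∎)
  where open ≡-Reasoning

∣⊥─p∣≡0 : ∀ (p : Subset n) → ∣ ⊥ ─ p ∣ ≡ 0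
∣⊥─p∣≡0 {n} p = n≤0⇒n≡0 (subst (∣ ⊥ ─ p ∣ ≤_) (∣⊥∣≡0 n) (∣p─q∣≤∣p∣ ⊥ p))

─-++ : ∀ {m} (p p′ : Subset m) (q q′ : Subset n) → (p ++ q) ─ (p′ ++ q′) ≡ (p ─ p′) ++ (q ─ q′)
─-++ p p′ q q′ = zipWith-++ _ p q p′ q′

∀∈⇒∣p∣≡n : ∀ {p : Subset n} → (∀ x → x ∈ p) → ∣ p ∣ ≡ n
∀∈⇒∣p∣≡n {n} all = trans (cong ∣_∣ (⊆-antisym ⊆⊤ (λ {x} _ → all x))) (∣⊤∣≡n n)

∣p∣≢0⇒Nonempty : ∀ {p : Subset n} → ∣ p ∣ ≢ 0 → Nonempty p
∣p∣≢0⇒Nonempty {n} {p} ∣p∣≢0 with nonempty? p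
... | yes ne = ne
... | no  empty = ⊥-elim (∣p∣≢0 (trans (cong ∣_∣ (Empty-unique empty)) (∣⊥∣≡0 n)))

infix 9 ⋃[_]_

⋃[_]_ : Subset c → (Fin c → Subset n) → Subset n
⋃[ []        ] F = ⊥
⋃[ true  ∷ S ] F = F zero ∪ ⋃[ S ] (λ p → F (suc p))
⋃[ false ∷ S ] F = ⋃[ S ] (λ p → F (suc p))

∈-⋃⁺ : ∀ {S : Subset c} {F : Fin c → Subset n} {p x} → p ∈ S → x ∈ F p → x ∈ ⋃[ S ] F
∈-⋃⁺ {S = true  ∷ S} {p = zero}  here        x∈ = x∈p∪q⁺ (inj₁ x∈)
∈-⋃⁺ {S = true  ∷ S} {F} {suc p} (there p∈S) x∈ = x∈p∪q⁺ {p = F zero} (inj₂ (∈-⋃⁺ p∈S x∈))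
∈-⋃⁺ {S = false ∷ S} {p = suc p} (there p∈S) x∈ = ∈-⋃⁺ p∈S x∈

∈-⋃⁻ : ∀ (S : Subset c) (F : Fin c → Subset n) {x} → x ∈ ⋃[ S ] F → ∃ λ p → p ∈ S × x ∈ F p
∈-⋃⁻ []          F x∈ = ⊥-elim (∉⊥ x∈)
∈-⋃⁻ (true ∷ S)  F x∈ with x∈p∪q⁻ (F zero) (⋃[ S ] (λ p → F (suc p))) x∈
... | inj₁ x∈F₀ = zero , here , x∈F₀
... | inj₂ x∈⋃  with ∈-⋃⁻ S (λ p → F (suc p)) x∈⋃
...   | p , p∈S , x∈Fp = suc p , there p∈S , x∈Fp
∈-⋃⁻ (false ∷ S) F x∈ with ∈-⋃⁻ S (λ p → F (suc p)) x∈
... | p , p∈S , x∈Fp = suc p , there p∈S , x∈Fp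

∣⋃∣≡∣S∣*K : ∀ (S : Subset c) (F : Fin c → Subset n) {K} →
            (∀ {x p q} → p ∈ S → q ∈ S → x ∈ F p → x ∈ F q → p ≡ q) →
            (∀ {p} → p ∈ S → ∣ F p ∣ ≡ K) → ∣ ⋃[ S ] F ∣ ≡ ∣ S ∣ * K
∣⋃∣≡∣S∣*K {n = n} []          F disj size = ∣⊥∣≡0 n
∣⋃∣≡∣S∣*K         (true ∷ S)  F disj size =
  trans (disjoint⇒∣p∪q∣≡∣p∣+∣q∣ F₀∩⋃-empty)
        (cong₂ _+_ (size here) (∣⋃∣≡∣S∣*K S _ disj-tail (λ p∈ → size (there p∈))))
  where
    disj-tail : ∀ {x p q} → p ∈ S → q ∈ S → x ∈ F (suc p) → x ∈ F (suc q) → p ≡ q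
    disj-tail p∈ q∈ x∈ x∈′ = Finₚ.suc-injective (disj (there p∈) (there q∈) x∈ x∈′)
    F₀∩⋃-empty : Disjoint (F zero) (⋃[ S ] (λ p → F (suc p)))
    F₀∩⋃-empty (x , x∈∩) with x∈p∩q⁻ _ _ x∈∩
    ... | x∈F₀ , x∈⋃ with ∈-⋃⁻ S _ x∈⋃
    ...   | p , p∈S , x∈Fp with disj here (there p∈S) x∈F₀ x∈Fp
    ...     | ()
∣⋃∣≡∣S∣*K         (false ∷ S) F disj size = ∣⋃∣≡∣S∣*K S _ disj-tail (λ p∈ → size (there p∈))
  where
    disj-tail : ∀ {x p q} → p ∈ S → q ∈ S → x ∈ F (suc p) → x ∈ F (suc q) → p ≡ q
    disj-tail p∈ q∈ x∈ x∈′ = Finₚ.suc-injective (disj (there p∈) (there q∈) x∈ x∈′)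

rank : Subset c → Fin c → ℕ
rank (_     ∷ S) zero    = 0
rank (true  ∷ S) (suc p) = suc (rank S p)
rank (false ∷ S) (suc p) = rank S p

rank-surjective : ∀ (S : Subset c) {r} → r < ∣ S ∣ → ∃ λ p → p ∈ S × rank S p ≡ r
rank-surjective (true  ∷ S) {zero}  _ = zero , here , refl
rank-surjective (true  ∷ S) {suc r} (s≤s r<∣S∣) with rank-surjective S r<∣S∣
... | p , p∈S , refl = suc p , there p∈S , refl
rank-surjective (false ∷ S) r<∣S∣ with rank-surjective S r<∣S∣
... | p , p∈S , refl = suc p , there p∈S , refl

-- Double changes

DoubleChange-sym : ∀ {n} {X Y : Subset n} → DoubleChange X Y → DoubleChange Y X
DoubleChange-sym (X─Y , Y─X) = Y─X , X─Y

module _ {v w : ℕ} where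

  ∣p++q─p′++q′∣ : ∀ (p p′ : Subset v) (q q′ : Subset w) → ∣ (p ++ q) ─ (p′ ++ q′) ∣ ≡ ∣ p ─ p′ ∣ + ∣ q ─ q′ ∣
  ∣p++q─p′++q′∣ p p′ q q′ = trans (cong ∣_∣ (─-++ p p′ q q′)) (∣p++q∣≡∣p∣+∣q∣ (p ─ p′) (q ─ q′))

  DoubleChange-++⊥ : ∀ {X Y : Subset v} → DoubleChange X Y → DoubleChange (X ++ ⊥ {w}) (Y ++ ⊥)
  DoubleChange-++⊥ {X} {Y} (X─Y , Y─X) =
    trans (∣p++q─p′++q′∣ X Y ⊥ ⊥) (cong₂ _+_ X─Y (∣⊥─p∣≡0 (⊥ {w}))) ,
    trans (∣p++q─p′++q′∣ Y X ⊥ ⊥) (cong₂ _+_ Y─X (∣⊥─p∣≡0 (⊥ {w})))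

  DoubleChange-⊇ : ∀ {Y U : Subset v} {e : Subset w} → U ⊆ Y → ∣ Y ∣ ≡ 2 + ∣ U ∣ → ∣ e ∣ ≡ 2 →
                   DoubleChange (Y ++ ⊥) (U ++ e)
  DoubleChange-⊇ {Y} {U} {e} U⊆Y ∣Y∣ ∣e∣ =
    trans (∣p++q─p′++q′∣ Y U ⊥ e) (cong₂ _+_ ∣Y─U∣ (∣⊥─p∣≡0 e)) ,
    trans (∣p++q─p′++q′∣ U Y e ⊥) (cong₂ _+_ (p⊆q⇒∣p─q∣≡0 U⊆Y) (trans (cong ∣_∣ (p─⊥≡p e)) ∣e∣))
    where
      ∣Y─U∣ : ∣ Y ─ U ∣ ≡ 2
      ∣Y─U∣ = +-cancelˡ-≡ ∣ U ∣ _ _ (begin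
        ∣ U ∣ + ∣ Y ─ U ∣     ≡⟨ cong (λ Z → ∣ Z ∣ + ∣ Y ─ U ∣) (trans (∩-comm Y U) (p⊆q⇒p∩q≡p U⊆Y)) ⟨
        ∣ Y ∩ U ∣ + ∣ Y ─ U ∣ ≡⟨ ∣p∣≡∣p∩q∣+∣p─q∣ Y U ⟨
        ∣ Y ∣                 ≡⟨ trans ∣Y∣ (+-comm 2 ∣ U ∣) ⟩
        ∣ U ∣ + 2 ∎)
        where open ≡-Reasoning

  DoubleChange-++ˡ : ∀ {U : Subset v} {e e′ : Subset w} → DoubleChange e e′ → DoubleChange (U ++ e) (U ++ e′)
  DoubleChange-++ˡ {U} {e} {e′} (e─e′ , e′─e) =
    trans (∣p++q─p′++q′∣ U U e e′) (cong₂ _+_ (p⊆q⇒∣p─q∣≡0 {p = U} ⊆-refl) e─e′) ,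
    trans (∣p++q─p′++q′∣ U U e′ e) (cong₂ _+_ (p⊆q⇒∣p─q∣≡0 {p = U} ⊆-refl) e′─e)

Disjoint⇒DoubleChange : ∀ {n} {e e′ : Subset n} → Disjoint e e′ → ∣ e ∣ ≡ 2 → ∣ e′ ∣ ≡ 2 → DoubleChange e e′
Disjoint⇒DoubleChange d ∣e∣ ∣e′∣ =
  trans (disjoint⇒∣p─q∣≡∣p∣ d) ∣e∣ , trans (disjoint⇒∣p─q∣≡∣p∣ (Disjoint-sym d)) ∣e′∣

DoubleChange⇒∣∩∣ : ∀ {n K} {X Y : Subset n} → ∣ X ∣ ≡ 2 + K → DoubleChange X Y → ∣ X ∩ Y ∣ ≡ K
DoubleChange⇒∣∩∣ {K = K} {X} {Y} ∣X∣ (X─Y , _) = +-cancelʳ-≡ 2 _ _ (begin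
  ∣ X ∩ Y ∣ + 2         ≡⟨ cong (∣ X ∩ Y ∣ +_) X─Y ⟨
  ∣ X ∩ Y ∣ + ∣ X ─ Y ∣ ≡⟨ ∣p∣≡∣p∩q∣+∣p─q∣ X Y ⟨
  ∣ X ∣                 ≡⟨ trans ∣X∣ (+-comm 2 K) ⟩
  K + 2                 ∎)
  where open ≡-Reasoning

-- Lists linked by a relation

module _ {A : Set} where

  last-++-∷ : ∀ (xs : List A) {y ys} → last (xs List.++ y ∷ ys) ≡ last (y ∷ ys)
  last-++-∷ []           = refl
  last-++-∷ (x ∷ [])     = refl
  last-++-∷ (x ∷ x′ ∷ xs) = last-++-∷ (x′ ∷ xs)

  last≡lookup : ∀ (xs : List A) (l : Fin (length xs)) → suc (toℕ l) ≡ length xs → last xs ≡ just (lookup xs l)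
  last≡lookup (x ∷ [])     zero    _ = refl
  last≡lookup (x ∷ x′ ∷ xs) (suc l) e = last≡lookup (x′ ∷ xs) l (suc-injective e)

module _ {A : Set} {R : A → A → Set} where

  All⇒Connected-head : ∀ {y xs} → All (R y) xs → Connected R (just y) (head xs)
  All⇒Connected-head []      = just-nothing
  All⇒Connected-head (r ∷ _) = just r

  All⇒Connected-last : ∀ {z xs} → All (λ x → R x z) xs → Connected R (last xs) (just z)
  All⇒Connected-last []           = nothing-just
  All⇒Connected-last (r ∷ [])     = just r
  All⇒Connected-last (_ ∷ r ∷ rs) = All⇒Connected-last (r ∷ rs)

  Linked-lookup : ∀ {xs} → Linked R xs → ∀ (i j : Fin (length xs)) → suc (toℕ i) ≡ toℕ j →
                  R (lookup xs i) (lookup xs j)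
  Linked-lookup (r ∷ _)  zero    (suc zero) _ = r
  Linked-lookup (_ ∷ rs) (suc i) (suc j)    e = Linked-lookup rs i j (suc-injective e)

  Connected-last-head⇒lookup : ∀ {xs : List A} → Connected R (last xs) (head xs) →
    ∀ (f l : Fin (length xs)) → toℕ f ≡ 0 → suc (toℕ l) ≡ length xs → R (lookup xs l) (lookup xs f)
  Connected-last-head⇒lookup {x ∷ xs} c zero l _ e with last≡lookup (x ∷ xs) l e
  ... | eq rewrite eq with c
  ...   | just r = r

m+[1+n+o]≡1+n+[m+o] : ∀ m n o → m + suc (n + o) ≡ suc n + (m + o)
m+[1+n+o]≡1+n+[m+o] = solve-∀

module _ {A : Set} where

  weave : ∀ c → (Fin (suc c) → List A) → (Fin c → A) → List A
  weave zero    runs X = runs zero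
  weave (suc c) runs X = runs zero List.++ X zero ∷ weave c (λ p → runs (suc p)) (λ i → X (suc i))

  ∈-weave-run : ∀ c {runs X x} p → x ∈ₗ runs p → x ∈ₗ weave c runs X
  ∈-weave-run zero    zero    x∈ = x∈
  ∈-weave-run (suc c) zero    x∈ = ∈-++⁺ˡ x∈
  ∈-weave-run (suc c) {runs} (suc p) x∈ = ∈-++⁺ʳ (runs zero) (there (∈-weave-run c p x∈))

  ∈-weave-skeleton : ∀ c {runs X} i → X i ∈ₗ weave c runs X
  ∈-weave-skeleton (suc c) {runs} zero    = ∈-++⁺ʳ (runs zero) (here refl)
  ∈-weave-skeleton (suc c) {runs} (suc i) = ∈-++⁺ʳ (runs zero) (there (∈-weave-skeleton c i))

  All-weave : ∀ {P : A → Set} c {runs X} → (∀ p → All P (runs p)) → (∀ i → P (X i)) → All P (weave c runs X)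
  All-weave zero    Pruns PX = Pruns zero
  All-weave (suc c) Pruns PX =
    All.++⁺ (Pruns zero) (PX zero ∷ All-weave c (λ p → Pruns (suc p)) (λ i → PX (suc i)))

  private
    length-first : ∀ {c} {runs : Fin (suc c) → List A} s (S : Subset c) {L} →
                   (∀ p → p ∈ s ∷ S → length (runs p) ≡ L) → (∀ p → p ∉ s ∷ S → runs p ≡ []) →
                   length (runs zero) + ∣ S ∣ * L ≡ ∣ s ∷ S ∣ * L
    length-first true  S in-S _     = cong (_+ _) (in-S zero here)
    length-first false S _    out-S = cong (λ r → length r + _) (out-S zero λ ())

  length-weave : ∀ c {runs X} (S : Subset (suc c)) {L} → (∀ p → p ∈ S → length (runs p) ≡ L) →
                 (∀ p → p ∉ S → runs p ≡ []) → length (weave c runs X) ≡ c + ∣ S ∣ * L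
  length-weave zero    (s ∷ []) in-S out-S = trans (sym (+-identityʳ _)) (length-first s [] in-S out-S)
  length-weave (suc c) {runs} {X} (s ∷ S) {L} in-S out-S = begin
    length (runs zero List.++ X zero ∷ _)  ≡⟨ length-++ (runs zero) ⟩
    length (runs zero) + suc (length (weave c _ _))
      ≡⟨ cong (λ l → length (runs zero) + suc l)
           (length-weave c S (λ p p∈S → in-S (suc p) (there p∈S))
                             (λ p p∉S → out-S (suc p) (p∉S ∘ drop-there))) ⟩
    length (runs zero) + suc (c + ∣ S ∣ * L) ≡⟨ m+[1+n+o]≡1+n+[m+o] (length (runs zero)) c _ ⟩
    suc c + (length (runs zero) + ∣ S ∣ * L) ≡⟨ cong (suc c +_) (length-first s S in-S out-S) ⟩
    suc c + ∣ s ∷ S ∣ * L ∎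
    where open ≡-Reasoning

  last-weave : ∀ c {runs X} → last (weave (suc c) runs X) ≡ last (X (fromℕ c) ∷ runs (fromℕ (suc c)))
  last-weave zero    {runs} = last-++-∷ (runs zero)
  last-weave (suc c) {runs} {X} = begin
    last (weave (suc (suc c)) runs X)
      ≡⟨ last-++-∷ (runs zero) {X zero} {rest} ⟩
    last ((X zero ∷ runs (suc zero)) List.++ X (suc zero) ∷ w)
      ≡⟨ last-++-∷ (X zero ∷ runs (suc zero)) {X (suc zero)} {w} ⟩
    last (X (suc zero) ∷ w)
      ≡⟨ last-++-∷ (runs (suc zero)) {X (suc zero)} {w} ⟨
    last rest
      ≡⟨ last-weave c {λ p → runs (suc p)} {λ i → X (suc i)} ⟩
    last (X (fromℕ (suc c)) ∷ runs (fromℕ (suc (suc c)))) ∎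
    where
      open ≡-Reasoning
      rest w : List A
      rest = weave (suc c) (λ p → runs (suc p)) (λ i → X (suc i))
      w    = weave c (λ p → runs (suc (suc p))) (λ i → X (suc (suc i)))

module _ {A : Set} {R : A → A → Set} where

  record Weavable (c : ℕ) (runs : Fin (suc c) → List A) (X : Fin c → A) : Set where
    field
      runs-linked     : ∀ p → Linked R (runs p)
      run→skeleton    : ∀ i → All (λ x → R x (X i)) (runs (inject₁ i))
      skeleton→run    : ∀ i → All (R (X i)) (runs (suc i))
      skeleton-linked : ∀ i j → suc (toℕ i) ≡ toℕ j → R (X i) (X j)
  open Weavable

  Weavable-tail : ∀ {c runs X} → Weavable (suc c) runs X → Weavable c (λ p → runs (suc p)) (λ i → X (suc i))
  Weavable-tail w = record
    { runs-linked     = λ p → runs-linked w (suc p)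
    ; run→skeleton    = λ i → run→skeleton w (suc i)
    ; skeleton→run    = λ i → skeleton→run w (suc i)
    ; skeleton-linked = λ i j e → skeleton-linked w (suc i) (suc j) (cong suc e)
    }

  Linked-∷-weave : ∀ c {runs X} → Weavable c runs X → ∀ {y} → All (R y) (runs zero) →
                   (∀ i → toℕ i ≡ 0 → R y (X i)) → Linked R (y ∷ weave c runs X)
  Linked-∷-weave zero    w y→run _ = All⇒Connected-head y→run ∷′ runs-linked w zero
  Linked-∷-weave (suc c) w y→run y→X =
    Linked.++⁺ (All⇒Connected-head y→run ∷′ runs-linked w zero)
               (All⇒Connected-last (y→X zero refl ∷ run→skeleton w zero))
               (Linked-∷-weave c (Weavable-tail w) (skeleton→run w zero)
                  (λ i e → skeleton-linked w zero (suc i) (cong suc (sym e))))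

  Linked-weave : ∀ c {runs X} → Weavable c runs X → Linked R (weave c runs X)
  Linked-weave zero    w = runs-linked w zero
  Linked-weave (suc c) w =
    Linked.++⁺ (runs-linked w zero) (All⇒Connected-last (run→skeleton w zero))
               (Linked-∷-weave c (Weavable-tail w) (skeleton→run w zero)
                  (λ i e → skeleton-linked w zero (suc i) (cong suc (sym e))))

  Connected-last-head-weave : ∀ c {runs X} → Weavable (suc c) runs X →
    runs zero ≡ [] ⊎ runs (fromℕ (suc c)) ≡ [] →
    All (R (X (fromℕ c))) (runs zero) → All (λ x → R x (X zero)) (runs (fromℕ (suc c))) →
    R (X (fromℕ c)) (X zero) → Connected R (last (weave (suc c) runs X)) (head (weave (suc c) runs X))
  Connected-last-head-weave c {runs} {X} w (inj₁ first≡[]) _ last→X₀ Xₗ→X₀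
    rewrite last-weave c {runs} {X} | first≡[] = All⇒Connected-last (Xₗ→X₀ ∷ last→X₀)
  Connected-last-head-weave c {runs} {X} w (inj₂ last≡[]) Xₗ→first _ Xₗ→X₀
    rewrite last-weave c {runs} {X} | last≡[] =
      Linked.head′ (Linked-∷-weave (suc c) w Xₗ→first (λ { zero refl → Xₗ→X₀ }))

-- Residues and the round-robin one-factorisation

module _ (M : ℕ) .{{_ : NonZero M}} where

  %-shift-≢ : ∀ x {d} → 0 < d → d < M → x % M ≢ (x + d) % M
  %-shift-≢ x {d} 0<d d<M eq = <⇒≱ d<M (∣⇒≤ {{>-nonZero 0<d}} M∣d)
    where
      multiples : x / M * M + d ≡ (x + d) / M * M
      multiples = +-cancelˡ-≡ (x % M) _ _ (begin
        x % M + (x / M * M + d)      ≡⟨ +-assoc (x % M) _ d ⟨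
        x % M + x / M * M + d        ≡⟨ cong (_+ d) (m≡m%n+[m/n]*n x M) ⟨
        x + d                        ≡⟨ m≡m%n+[m/n]*n (x + d) M ⟩
        (x + d) % M + (x + d) / M * M ≡⟨ cong (_+ (x + d) / M * M) eq ⟨
        x % M + (x + d) / M * M      ∎)
        where open ≡-Reasoning
      M∣d : M ∣ d
      M∣d = ∣m+n∣m⇒∣n (divides ((x + d) / M) multiples) (n∣m*n (x / M))

  %-≢-window : ∀ x {a b} → a < b → b < M → (x + a) % M ≢ (x + b) % M
  %-≢-window x {a} {b} a<b b<M eq =
    %-shift-≢ (x + a) (m<n⇒0<n∸m a<b) (≤-<-trans (m∸n≤m b a) b<M) (trans eq (cong (_% M) x+b≡x+a+[b∸a]))
    where
      x+b≡x+a+[b∸a] : x + b ≡ x + a + (b ∸ a)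
      x+b≡x+a+[b∸a] = trans (cong (x +_) (sym (m+[n∸m]≡n (<⇒≤ a<b)))) (sym (+-assoc x a _))

  %-injective-window : ∀ x {a b} → a < M → b < M → (x + a) % M ≡ (x + b) % M → a ≡ b
  %-injective-window x {a} {b} a<M b<M eq with <-cmp a b
  ... | tri< a<b _ _ = ⊥-elim (%-≢-window x a<b b<M eq)
  ... | tri≈ _ a≡b _ = a≡b
  ... | tri> _ _ b<a = ⊥-elim (%-≢-window x b<a a<M (sym eq))

  [m%n+k]%n≡[m+k]%n : ∀ x y → (x % M + y) % M ≡ (x + y) % M
  [m%n+k]%n≡[m+k]%n x y = begin
    (x % M + y) % M         ≡⟨ %-distribˡ-+ (x % M) y M ⟩
    (x % M % M + y % M) % M ≡⟨ cong (λ r → (r + y % M) % M) (m%n%n≡m%n x M) ⟩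
    (x % M + y % M) % M     ≡⟨ %-distribˡ-+ x y M ⟨
    (x + y) % M             ∎
    where open ≡-Reasoning

m+m≤n+n⇒m≤n : ∀ {m n} → m + m ≤ n + n → m ≤ n
m+m≤n+n⇒m≤n le = ≮⇒≥ (λ n<m → <⇒≱ (+-mono-< n<m n<m) le)

m+m<n+n⇒m<n : ∀ {m n} → m + m < n + n → m < n
m+m<n+n⇒m<n lt = ≰⇒> (λ n≤m → <⇒≱ lt (+-mono-≤ n≤m n≤m))

even-or-odd : ∀ d → ∃ λ q → d ≡ q + q ⊎ d ≡ suc (q + q)
even-or-odd zero = 0 , inj₁ refl
even-or-odd (suc d) with even-or-odd d
... | q , inj₁ d≡q+q = q , inj₂ (cong suc d≡q+q)
... | q , inj₂ d≡1+q+q = suc q , inj₁ (trans (cong suc d≡1+q+q) (cong suc (sym (+-suc q q))))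

-- Points 0, …, M − 1 are the residues mod M and M is the point at infinity: edge j 0 is {∞, j} and
-- edge j t is {j + t, j − t} for 1 ≤ t ≤ n, so factor j is the j-th round-robin one-factor.
module RoundRobin (n : ℕ) where

  M : ℕ
  M = suc (n + n)

  n<M : n < M
  n<M = s≤s (m≤m+n n n)

  end⁺ end⁻ : ℕ → ℕ → ℕ
  end⁺ j zero    = M
  end⁺ j (suc t) = (j + suc t) % M
  end⁻ j t       = (j + (M ∸ t)) % M

  end⁺≤M : ∀ j t → end⁺ j t ≤ M
  end⁺≤M j zero    = ≤-refl
  end⁺≤M j (suc t) = <⇒≤ (m%n<n (j + suc t) M)

  end⁻≤M : ∀ j t → end⁻ j t ≤ M
  end⁻≤M j t = <⇒≤ (m%n<n (j + (M ∸ t)) M)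

  M≢%M : ∀ x → M ≢ x % M
  M≢%M x eq = <⇒≢ (m%n<n x M) (sym eq)

  end⁺≢end⁻ : ∀ j {t t′} → t ≤ n → t′ ≤ n → end⁺ j t ≢ end⁻ j t′
  end⁺≢end⁻ j {zero} {t′}     _   _    = M≢%M (j + (M ∸ t′))
  end⁺≢end⁻ j {suc t} {t′} t<n t′≤n eq =
    %-shift-≢ M x (s≤s z≤n) (s≤s (+-mono-≤ t<n t′≤n)) (begin
      x % M                          ≡⟨ eq ⟨
      (j + suc t) % M                ≡⟨ [m+n]%n≡m%n (j + suc t) M ⟨
      (j + suc t + M) % M            ≡⟨ cong (λ y → (j + suc t + y) % M) (m∸n+n≡m (≤-trans t′≤n (<⇒≤ n<M))) ⟨
      (j + suc t + (M ∸ t′ + t′)) % M ≡⟨ cong (_% M) (rearrange j (suc t) (M ∸ t′) t′) ⟩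
      (x + (suc t + t′)) % M         ∎)
    where
      open ≡-Reasoning
      x = j + (M ∸ t′)
      rearrange : ∀ j a b c → j + a + (b + c) ≡ j + b + (a + c)
      rearrange = solve-∀

  end⁺-injective : ∀ j {t t′} → t ≤ n → t′ ≤ n → end⁺ j t ≡ end⁺ j t′ → t ≡ t′
  end⁺-injective j {zero}  {zero}   _   _    _  = refl
  end⁺-injective j {zero}  {suc t′} _   _    eq = ⊥-elim (M≢%M (j + suc t′) eq)
  end⁺-injective j {suc t} {zero}   _   _    eq = ⊥-elim (M≢%M (j + suc t) (sym eq))
  end⁺-injective j {suc t} {suc t′} t≤n t′≤n eq =
    %-injective-window M j (≤-<-trans t≤n n<M) (≤-<-trans t′≤n n<M) eq

  end⁻-injective : ∀ j {t t′} → t ≤ n → t′ ≤ n → end⁻ j t ≡ end⁻ j t′ → t ≡ t′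
  end⁻-injective j {t} {t′} t≤n t′≤n eq =
    ∸-cancelˡ-≡ t≤n t′≤n
      (%-injective-window M (j + suc n) (≤-<-trans (m∸n≤m n t) n<M) (≤-<-trans (m∸n≤m n t′) n<M)
        (trans (cong (_% M) (sym (shift t≤n))) (trans eq (cong (_% M) (shift t′≤n)))))
    where
      shift : ∀ {t} → t ≤ n → j + (M ∸ t) ≡ j + suc n + (n ∸ t)
      shift t≤n = trans (cong (j +_) (+-∸-assoc (suc n) t≤n)) (sym (+-assoc j (suc n) _))

  point : ∀ {x} → x ≤ M → Fin (suc M)
  point x≤M = fromℕ< (s≤s x≤M)

  edge : ℕ → ℕ → Subset (suc M)
  edge j t = ⁅ point (end⁺≤M j t) ⁆ ∪ ⁅ point (end⁻≤M j t) ⁆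

  ∈-edge⁺ : ∀ {j t y} → toℕ y ≡ end⁺ j t ⊎ toℕ y ≡ end⁻ j t → y ∈ edge j t
  ∈-edge⁺ {j} {t} {y} (inj₁ y≡end⁺) =
    x∈p∪q⁺ (inj₁ (subst (_∈ ⁅ _ ⁆) (sym (toℕ-injective (trans y≡end⁺ (sym (toℕ-fromℕ< _))))) (x∈⁅x⁆ _)))
  ∈-edge⁺ {j} {t} {y} (inj₂ y≡end⁻) = x∈p∪q⁺ {p = ⁅ point (end⁺≤M j t) ⁆}
    (inj₂ (subst (_∈ ⁅ _ ⁆) (sym (toℕ-injective (trans y≡end⁻ (sym (toℕ-fromℕ< _))))) (x∈⁅x⁆ _)))

  ∈-edge⁻ : ∀ {j t y} → y ∈ edge j t → toℕ y ≡ end⁺ j t ⊎ toℕ y ≡ end⁻ j t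
  ∈-edge⁻ {j} {t} y∈ with x∈p∪q⁻ ⁅ point (end⁺≤M j t) ⁆ _ y∈
  ... | inj₁ y∈⁺ = inj₁ (trans (cong toℕ (x∈⁅y⁆⇒x≡y _ y∈⁺)) (toℕ-fromℕ< _))
  ... | inj₂ y∈⁻ = inj₂ (trans (cong toℕ (x∈⁅y⁆⇒x≡y _ y∈⁻)) (toℕ-fromℕ< _))

  edge-injective : ∀ {j t t′ y} → t ≤ n → t′ ≤ n → y ∈ edge j t → y ∈ edge j t′ → t ≡ t′
  edge-injective {j} {t} {t′} t≤n t′≤n y∈ y∈′ with ∈-edge⁻ {j} {t} y∈ | ∈-edge⁻ {j} {t′} y∈′
  ... | inj₁ y≡ | inj₁ y≡′ = end⁺-injective j t≤n t′≤n (trans (sym y≡) y≡′)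
  ... | inj₁ y≡ | inj₂ y≡′ = ⊥-elim (end⁺≢end⁻ j t≤n t′≤n (trans (sym y≡) y≡′))
  ... | inj₂ y≡ | inj₁ y≡′ = ⊥-elim (end⁺≢end⁻ j t′≤n t≤n (trans (sym y≡′) y≡))
  ... | inj₂ y≡ | inj₂ y≡′ = end⁻-injective j t≤n t′≤n (trans (sym y≡) y≡′)

  ∣edge∣≡2 : ∀ {j t} → t ≤ n → ∣ edge j t ∣ ≡ 2
  ∣edge∣≡2 {j} {t} t≤n =
    trans (disjoint⇒∣p∪q∣≡∣p∣+∣q∣ ends-differ) (cong₂ _+_ (∣⁅x⁆∣≡1 (point (end⁺≤M j t))) (∣⁅x⁆∣≡1 (point (end⁻≤M j t))))
    where
      ends-differ : Disjoint ⁅ point (end⁺≤M j t) ⁆ ⁅ point (end⁻≤M j t) ⁆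
      ends-differ (y , y∈∩) with x∈p∩q⁻ _ _ y∈∩
      ... | y∈⁺ , y∈⁻ = end⁺≢end⁻ j t≤n t≤n (begin
        end⁺ j t                     ≡⟨ toℕ-fromℕ< _ ⟨
        toℕ (point (end⁺≤M j t))     ≡⟨ cong toℕ (trans (sym (x∈⁅y⁆⇒x≡y _ y∈⁺)) (x∈⁅y⁆⇒x≡y _ y∈⁻)) ⟩
        toℕ (point (end⁻≤M j t))     ≡⟨ toℕ-fromℕ< _ ⟩
        end⁻ j t                     ∎)
        where open ≡-Reasoning

  factor : ℕ → List (Subset (suc M))
  factor j = applyUpTo (edge j) (suc n)

  Linked-factor : ∀ j → Linked DoubleChange (factor j)
  Linked-factor j = Linked.applyUpTo⁺₁ (edge j) (suc n) consecutive
    where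
      consecutive : ∀ {t} → suc t < suc n → DoubleChange (edge j t) (edge j (suc t))
      consecutive {t} (s≤s t<n) = Disjoint⇒DoubleChange disjoint (∣edge∣≡2 {j} (<⇒≤ t<n)) (∣edge∣≡2 {j} t<n)
        where
          disjoint : Disjoint (edge j t) (edge j (suc t))
          disjoint (y , y∈∩) with x∈p∩q⁻ _ _ y∈∩
          ... | y∈ , y∈′ = <⇒≢ (n<1+n t) (edge-injective {j} (<⇒≤ t<n) t<n y∈ y∈′)

  All-factor-pairs : ∀ j → All (λ e → ∣ e ∣ ≡ 2) (factor j)
  All-factor-pairs j = All.applyUpTo⁺₁ (edge j) (suc n) (λ t<1+n → ∣edge∣≡2 {j} (s≤s⁻¹ t<1+n))

  ∈-factor : ∀ {j t} → t ≤ n → edge j t ∈ₗ factor j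
  ∈-factor {j} t≤n = ∈-applyUpTo⁺ (edge j) (s≤s t≤n)

  -- The n + 1 pairwise disjoint pairs of a factor fill all 2n + 2 points.
  edge-through-point : ∀ j y → ∃ λ t → t ≤ n × y ∈ edge j t
  edge-through-point j y with ∈-⋃⁻ ⊤ F (subst (y ∈_) (sym ⋃F≡⊤) ∈⊤)
    where
      F : Fin (suc n) → Subset (suc M)
      F t = edge j (toℕ t)
      ∣⋃F∣ : ∣ ⋃[ ⊤ ] F ∣ ≡ suc M
      ∣⋃F∣ = begin
        ∣ ⋃[ ⊤ ] F ∣ ≡⟨ ∣⋃∣≡∣S∣*K ⊤ F (λ {_} {p} {q} _ _ → λ y∈ y∈′ →
                           toℕ-injective (edge-injective {j} (toℕ≤pred[n] p) (toℕ≤pred[n] q) y∈ y∈′))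
                         (λ {p} _ → ∣edge∣≡2 {j} (toℕ≤pred[n] p)) ⟩
        ∣ ⊤ {suc n} ∣ * 2 ≡⟨ cong (_* 2) (∣⊤∣≡n (suc n)) ⟩
        suc n * 2    ≡⟨ *-comm (suc n) 2 ⟩
        suc n + (suc n + 0) ≡⟨ cong suc (trans (cong (n +_) (+-identityʳ (suc n))) (+-suc n n)) ⟩
        suc M        ∎
        where open ≡-Reasoning
      ⋃F≡⊤ : ⋃[ ⊤ ] F ≡ ⊤
      ⋃F≡⊤ = ∣p∣≡n⇒p≡⊤ ∣⋃F∣
  ... | t , _ , y∈ = toℕ t , toℕ≤pred[n] t , y∈

  end⁺-centred : ∀ x {t} → 0 < t → end⁺ ((x + t) % M) t ≡ (x + t + t) % M
  end⁺-centred x {suc t} _ = [m%n+k]%n≡[m+k]%n M (x + suc t) (suc t)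

  end⁻-centred : ∀ x {t} → t ≤ M → end⁻ ((x + t) % M) t ≡ x % M
  end⁻-centred x {t} t≤M = begin
    ((x + t) % M + (M ∸ t)) % M ≡⟨ [m%n+k]%n≡[m+k]%n M (x + t) (M ∸ t) ⟩
    (x + t + (M ∸ t)) % M      ≡⟨ cong (_% M) (trans (+-assoc x t _) (cong (x +_) (m+[n∸m]≡n t≤M))) ⟩
    (x + M) % M                ≡⟨ [m+n]%n≡m%n x M ⟩
    x % M                      ∎
    where open ≡-Reasoning

  Joins : ℕ → ℕ → ℕ → ℕ → Set
  Joins j t a c = (a ≡ end⁻ j t × c ≡ end⁺ j t) ⊎ (a ≡ end⁺ j t × c ≡ end⁻ j t)

  -- The edge joining a < c is centred at their midpoint: at a + (c − a)/2 if c − a is even, and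
  -- otherwise at c + (a + M − c)/2, the distance from c round to a + M being even.
  edge-joining : ∀ {a c} → a < c → c ≤ M → ∃ λ j → j < M × ∃ λ t → t ≤ n × Joins j t a c
  edge-joining {a} {c} a<c c≤M with c ≟ M
  ... | yes refl = a , a<c , 0 , z≤n , inj₁ (sym (trans ([m+n]%n≡m%n a M) (m<n⇒m%n≡m a<c)) , refl)
  ... | no c≢M with even-or-odd (c ∸ a)
  ...   | zero , inj₁ c∸a≡0 = ⊥-elim (<⇒≢ (m<n⇒0<n∸m a<c) (sym c∸a≡0))
  ...   | suc q , inj₁ c∸a≡q+q =
    (a + suc q) % M , m%n<n (a + suc q) M , suc q , q≤n , inj₁ (sym a-end , sym c-end)
    where
      c<M = ≤∧≢⇒< c≤M c≢M
      q≤n : suc q ≤ n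
      q≤n = m+m≤n+n⇒m≤n (s≤s⁻¹ (≤-<-trans (≤-trans (≤-reflexive (sym c∸a≡q+q)) (m∸n≤m c a)) c<M))
      a-end : end⁻ ((a + suc q) % M) (suc q) ≡ a
      a-end = trans (end⁻-centred a (≤-trans q≤n (<⇒≤ n<M))) (m<n⇒m%n≡m (<-trans a<c c<M))
      c-end : end⁺ ((a + suc q) % M) (suc q) ≡ c
      c-end = trans (end⁺-centred a (s≤s z≤n)) (trans (cong (_% M) (trans (+-assoc a (suc q) (suc q))
                (trans (cong (a +_) (sym c∸a≡q+q)) (m+[n∸m]≡n (<⇒≤ a<c))))) (m<n⇒m%n≡m c<M))
  ...   | q , inj₂ c∸a≡1+q+q =
    (c + t) % M , m%n<n (c + t) M , t , m∸n≤m n q , inj₂ (sym a-end , sym c-end)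
    where
      c<M = ≤∧≢⇒< c≤M c≢M
      t = n ∸ q
      q<n : q < n
      q<n = m+m<n+n⇒m<n (s<s⁻¹ (≤-<-trans (≤-trans (≤-reflexive (sym c∸a≡1+q+q)) (m∸n≤m c a)) c<M))
      wrap : c + t + t ≡ a + M
      wrap = begin
        c + t + t                 ≡⟨ cong (λ z → z + t + t) (m+[n∸m]≡n (<⇒≤ a<c)) ⟨
        a + (c ∸ a) + t + t       ≡⟨ cong (λ z → a + z + t + t) c∸a≡1+q+q ⟩
        a + suc (q + q) + t + t   ≡⟨ regroup a q t ⟩
        a + suc ((q + t) + (q + t)) ≡⟨ cong (λ z → a + suc (z + z)) (m+[n∸m]≡n (<⇒≤ q<n)) ⟩
        a + M                     ∎
        where
          open ≡-Reasoning
          regroup : ∀ a q t → a + suc (q + q) + t + t ≡ a + suc ((q + t) + (q + t))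
          regroup = solve-∀
      a-end : end⁺ ((c + t) % M) t ≡ a
      a-end = trans (end⁺-centred c (m<n⇒0<n∸m q<n))
                (trans (cong (_% M) wrap) (trans ([m+n]%n≡m%n a M) (m<n⇒m%n≡m (<-trans a<c c<M))))
      c-end : end⁻ ((c + t) % M) t ≡ c
      c-end = trans (end⁻-centred c (≤-trans (m∸n≤m n q) (<⇒≤ n<M))) (m<n⇒m%n≡m c<M)

  Joins⇒∈-edge : ∀ {j t} {y y′ : Fin (suc M)} → Joins j t (toℕ y) (toℕ y′) → y ∈ edge j t × y′ ∈ edge j t
  Joins⇒∈-edge {j} {t} (inj₁ (y≡ , y′≡)) = ∈-edge⁺ {j} {t} (inj₂ y≡) , ∈-edge⁺ {j} {t} (inj₁ y′≡)
  Joins⇒∈-edge {j} {t} (inj₂ (y≡ , y′≡)) = ∈-edge⁺ {j} {t} (inj₁ y≡) , ∈-edge⁺ {j} {t} (inj₂ y′≡)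

  edge-through-pair : ∀ (y y′ : Fin (suc M)) → y ≢ y′ →
                ∃ λ j → j < M × ∃ λ t → t ≤ n × y ∈ edge j t × y′ ∈ edge j t
  edge-through-pair y y′ y≢y′ with <-cmp (toℕ y) (toℕ y′)
  ... | tri≈ _ y≡y′ _ = ⊥-elim (y≢y′ (toℕ-injective y≡y′))
  ... | tri< y<y′ _ _ with edge-joining y<y′ (toℕ≤pred[n] y′)
  ...   | j , j<M , t , t≤n , joins = j , j<M , t , t≤n , Joins⇒∈-edge {j} {t} joins
  edge-through-pair y y′ y≢y′ | tri> _ _ y′<y with edge-joining y′<y (toℕ≤pred[n] y)
  ...   | j , j<M , t , t≤n , joins with Joins⇒∈-edge {j} {t} {y′} {y} joins
  ...     | y′∈ , y∈ = j , j<M , t , t≤n , y∈ , y′∈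

-- Binomial coefficients and the bounds g₁, g₂

[1+n]C2≡n+nC2 : ∀ n → suc n C 2 ≡ n + n C 2
[1+n]C2≡n+nC2 n = trans (sym (nCk+nC[k+1]≡[n+1]C[k+1] n 1)) (cong (_+ n C 2) (nC1≡n n))

2*nC2+n≡n*n : ∀ n → 2 * (n C 2) + n ≡ n * n
2*nC2+n≡n*n zero    = refl
2*nC2+n≡n*n (suc n) = begin
  2 * (suc n C 2) + suc n      ≡⟨ cong (λ c → 2 * c + suc n) ([1+n]C2≡n+nC2 n) ⟩
  2 * (n + n C 2) + suc n      ≡⟨ regroup n (n C 2) ⟩
  (2 * (n C 2) + n) + suc (n + n) ≡⟨ cong (_+ suc (n + n)) (2*nC2+n≡n*n n) ⟩
  n * n + suc (n + n)          ≡⟨ square n ⟩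
  suc n * suc n                ∎
  where
    open ≡-Reasoning
    regroup : ∀ n c → 2 * (n + c) + suc n ≡ (2 * c + n) + suc (n + n)
    regroup = solve-∀
    square : ∀ n → n * n + suc (n + n) ≡ suc n * suc n
    square = solve-∀

C2-mono-≤ : ∀ {m n} → m ≤ n → m C 2 ≤ n C 2
C2-mono-≤ {zero}  _ = z≤n
C2-mono-≤ {suc m} {suc n} (s≤s m≤n) rewrite [1+n]C2≡n+nC2 m | [1+n]C2≡n+nC2 n =
  +-mono-≤ m≤n (C2-mono-≤ m≤n)

ceilDiv-+* : ∀ a {d} X → 0 < d → ceilDiv (a + d * X) d ≡ ceilDiv a d + X
ceilDiv-+* a {suc d} X _ = begin
  (a + suc d * X + d) / suc d         ≡⟨ cong (_/ suc d) (regroup a d X) ⟩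
  ((a + d) + X * suc d) / suc d       ≡⟨ +-distrib-/-∣ʳ (a + d) (n∣m*n X) ⟩
  (a + d) / suc d + X * suc d / suc d ≡⟨ cong ((a + d) / suc d +_) (m*n/n≡m X (suc d)) ⟩
  (a + d) / suc d + X                 ∎
  where
    open ≡-Reasoning
    regroup : ∀ a d X → a + suc d * X + d ≡ (a + d) + X * suc d
    regroup = solve-∀

module Growth (v v* k Δ : ℕ) (grow : v* C 2 ≡ v C 2 + (2 * k ∸ 3) * Δ) (0<2k∸3 : 0 < 2 * k ∸ 3) where

  EconomicalCirc-grow : ∀ {b} → EconomicalCirc v k b → EconomicalCirc v* k (b + Δ)
  EconomicalCirc-grow refl =
    sym (trans (cong (λ a → ceilDiv a (2 * k ∸ 3)) grow) (ceilDiv-+* (v C 2) Δ 0<2k∸3))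

  TightCirc-grow : ∀ {b} → TightCirc v k b → TightCirc v* k (b + Δ)
  TightCirc-grow (economical , d∣vC2) =
    EconomicalCirc-grow economical ,
    subst ((2 * k ∸ 3) ∣_) (sym grow) (∣m∣n⇒∣m+n d∣vC2 (m∣m*n {2 * k ∸ 3} Δ))

  module _ (kC2≤vC2 : k C 2 ≤ v C 2) where

    pairs-grow : v* C 2 ∸ k C 2 ≡ (v C 2 ∸ k C 2) + (2 * k ∸ 3) * Δ
    pairs-grow = trans (cong (_∸ k C 2) grow) (+-∸-comm _ kC2≤vC2)

    EconomicalLin-grow : ∀ {b} → EconomicalLin v k b → EconomicalLin v* k (b + Δ)
    EconomicalLin-grow refl = sym (cong suc
      (trans (cong (λ a → ceilDiv a (2 * k ∸ 3)) pairs-grow) (ceilDiv-+* (v C 2 ∸ k C 2) Δ 0<2k∸3)))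

    TightLin-grow : ∀ {b} → TightLin v k b → TightLin v* k (b + Δ)
    TightLin-grow (economical , d∣pairs) =
      EconomicalLin-grow economical ,
      subst ((2 * k ∸ 3) ∣_) (sym pairs-grow) (∣m∣n⇒∣m+n d∣pairs (m∣m*n {2 * k ∸ 3} Δ))

2*[2+K]∸3≡1+K+K : ∀ K → 2 * suc (suc K) ∸ 3 ≡ suc (K + K)
2*[2+K]∸3≡1+K+K K = trans (cong (_∸ 3) (expand K)) (m+n∸m≡n 3 (suc (K + K)))
  where
    expand : ∀ K → 2 * suc (suc K) ≡ 3 + suc (K + K)
    expand = solve-∀

[m+1]/2≡1+n : ∀ n → (suc (n + n) + 1) / 2 ≡ suc n
[m+1]/2≡1+n n = trans (cong (_/ 2) (double n)) (m*n/n≡m (suc n) 2)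
  where
    double : ∀ n → suc (n + n) + 1 ≡ suc n * 2
    double = solve-∀

-- Doubling turns x C 2 into x * x − x, after which both sides are polynomials in n and K.
C2-growth : ∀ n K → let m = suc (n + n) in
            (m * K + m + 1) C 2 ≡ (m * K) C 2 + (2 * suc (suc K) ∸ 3) * (m * ((m + 1) / 2))
C2-growth n K = begin
  N C 2
    ≡⟨ *-cancelˡ-≡ _ _ 2 (+-cancelʳ-≡ N _ _ doubled) ⟩
  v C 2 + suc (K + K) * (m * suc n)
    ≡⟨ cong₂ (λ d h → v C 2 + d * (m * h)) (2*[2+K]∸3≡1+K+K K) ([m+1]/2≡1+n n) ⟨
  v C 2 + (2 * suc (suc K) ∸ 3) * (m * ((m + 1) / 2)) ∎
  where
    open ≡-Reasoning
    m = suc (n + n)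
    v = m * K
    N = v + m + 1
    square : ∀ n K → let m = suc (n + n) ; v = m * K ; N = v + m + 1 in
             N * N ≡ v * v + (2 * (suc (K + K) * (m * suc n)) + (m + 1))
    square = solve-∀
    regroup : ∀ n K c → let m = suc (n + n) ; v = m * K ; N = v + m + 1 in
              2 * c + v + (2 * (suc (K + K) * (m * suc n)) + (m + 1)) ≡ 2 * (c + suc (K + K) * (m * suc n)) + N
    regroup = solve-∀
    rest : ℕ
    rest = 2 * (suc (K + K) * (m * suc n)) + (m + 1)
    doubled : 2 * (N C 2) + N ≡ 2 * (v C 2 + suc (K + K) * (m * suc n)) + N
    doubled = begin
      2 * (N C 2) + N ≡⟨ 2*nC2+n≡n*n N ⟩
      N * N           ≡⟨ square n K ⟩
      v * v + rest    ≡⟨ cong (_+ rest) (2*nC2+n≡n*n v) ⟨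
      2 * (v C 2) + v + rest ≡⟨ regroup n K (v C 2) ⟩
      2 * (v C 2 + suc (K + K) * (m * suc n)) + N ∎

-- Designs from lists of blocks, and unchanged subsets

Covers : ∀ {N} → List (Subset N) → Set
Covers {N} L = ∀ (x y : Fin N) → x ≢ y → ∃ λ X → X ∈ₗ L × x ∈ X × y ∈ X

IsDCCD-lookup : ∀ {N k} (L : List (Subset N)) → Linked DoubleChange L → All (λ X → ∣ X ∣ ≡ k) L → Covers L →
                IsDCCD N k (length L) (lookup L)
IsDCCD-lookup L linked sizes covers = record
  { blockSize = λ i → All.lookup sizes (∈-lookup i)
  ; covering  = covering
  ; change    = Linked-lookup linked
  }
  where
    covering : ∀ x y → x ≢ y → ∃ λ i → x ∈ lookup L i × y ∈ lookup L i
    covering x y x≢y with covers x y x≢y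
    ... | X , X∈L , x∈X , y∈X =
      index X∈L , subst (x ∈_) (lookup-index X∈L) x∈X , subst (y ∈_) (lookup-index X∈L) y∈X

IsCDCCD-lookup : ∀ {N k} (L : List (Subset N)) → Linked DoubleChange L → All (λ X → ∣ X ∣ ≡ k) L → Covers L →
                 Connected DoubleChange (last L) (head L) → IsCDCCD N k (length L) (lookup L)
IsCDCCD-lookup L linked sizes covers closed = record
  { isDCCD   = IsDCCD-lookup L linked sizes covers
  ; circular = Connected-last-head⇒lookup closed
  }

toℕ≡0⇒≡zero : ∀ {b} {f : Fin (suc b)} → toℕ f ≡ 0 → f ≡ zero
toℕ≡0⇒≡zero = toℕ-injective

toℕ≡n⇒≡fromℕ : ∀ {b} {l : Fin (suc b)} → toℕ l ≡ b → l ≡ fromℕ b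
toℕ≡n⇒≡fromℕ {b} l≡b = toℕ-injective (trans l≡b (sym (toℕ-fromℕ b)))

blk-toℕ : ∀ {v b} (B : Blocks v b) (i : Fin b) → blk B (toℕ i) ≡ B i
blk-toℕ {b = b} B i with toℕ i <? b
... | yes i<b = cong B (fromℕ<-toℕ i i<b)
... | no  i≮b = ⊥-elim (i≮b (toℕ<n i))

blk-fromℕ< : ∀ {v b} (B : Blocks v b) {t} (t<b : t < b) → blk B t ≡ B (fromℕ< t<b)
blk-fromℕ< B t<b = trans (cong (blk B) (sym (toℕ-fromℕ< t<b))) (blk-toℕ B (fromℕ< t<b))

Ufam-elim : ∀ {v b} (B : Blocks v b) U₀ Uₗ (P : Subset v → Set) (p : Fin (suc b)) →
            (toℕ p ≡ 0 → P U₀) → (toℕ p ≡ b → P Uₗ) →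
            (0 < toℕ p → toℕ p < b → P (blk B (toℕ p ∸ 1) ∩ blk B (toℕ p))) → P (Ufam B U₀ Uₗ p)
Ufam-elim {b = b} B U₀ Uₗ P p first final inner with toℕ p ≟ 0
... | yes p≡0 = first p≡0
... | no  p≢0 with toℕ p ≟ b
...   | yes p≡b = final p≡b
...   | no  p≢b = inner (n≢0⇒n>0 p≢0) (≤∧≢⇒< (toℕ≤pred[n] p) p≢b)

module Unchanged {v K b} {B : Blocks v (suc b)} (D : IsDCCD v (suc (suc K)) (suc b) B)
                 {U₀ Uₗ : Subset v} (U₀⊆B₀ : U₀ ⊆ B zero) (Uₗ⊆Bₗ : Uₗ ⊆ B (fromℕ b))
                 (∣U₀∣ : ∣ U₀ ∣ ≡ K) (∣Uₗ∣ : ∣ Uₗ ∣ ≡ K) where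
  open IsDCCD D

  U : Fin (suc (suc b)) → Subset v
  U = Ufam B U₀ Uₗ

  ∣U∣≡K : ∀ p → ∣ U p ∣ ≡ K
  ∣U∣≡K p = Ufam-elim B U₀ Uₗ (λ X → ∣ X ∣ ≡ K) p (λ _ → ∣U₀∣) (λ _ → ∣Uₗ∣) inner
    where
      inner : 0 < toℕ p → toℕ p < suc b → ∣ blk B (toℕ p ∸ 1) ∩ blk B (toℕ p) ∣ ≡ K
      inner 0<p p<b = subst₂ (λ X Y → ∣ X ∩ Y ∣ ≡ K) (sym (blk-fromℕ< B p∸1<b)) (sym (blk-fromℕ< B p<b))
                        (DoubleChange⇒∣∩∣ {X = B i} {B j} (blockSize i) (change i j consecutive))
        where
          p∸1<b = ≤-<-trans (m∸n≤m (toℕ p) 1) p<b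
          i = fromℕ< p∸1<b
          j = fromℕ< p<b
          consecutive : suc (toℕ i) ≡ toℕ j
          consecutive = trans (cong suc (toℕ-fromℕ< p∸1<b)) (trans (m+[n∸m]≡n 0<p) (sym (toℕ-fromℕ< p<b)))

  U-inject₁⊆B : ∀ i → U (inject₁ i) ⊆ B i
  U-inject₁⊆B i = Ufam-elim B U₀ Uₗ (_⊆ B i) (inject₁ i) first final inner
    where
      first : toℕ (inject₁ i) ≡ 0 → U₀ ⊆ B i
      first i≡0 = subst (λ j → U₀ ⊆ B j) (sym (toℕ≡0⇒≡zero (trans (sym (toℕ-inject₁ i)) i≡0))) U₀⊆B₀
      final : toℕ (inject₁ i) ≡ suc b → Uₗ ⊆ B i
      final i≡1+b = ⊥-elim (<⇒≢ (toℕ<n i) (trans (sym (toℕ-inject₁ i)) i≡1+b))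
      inner : _ → _ → blk B (toℕ (inject₁ i) ∸ 1) ∩ blk B (toℕ (inject₁ i)) ⊆ B i
      inner _ _ = subst (λ Z → blk B (toℕ (inject₁ i) ∸ 1) ∩ blk B (toℕ (inject₁ i)) ⊆ Z)
                    (trans (cong (blk B) (toℕ-inject₁ i)) (blk-toℕ B i)) (p∩q⊆q _ _)

  U-suc⊆B : ∀ i → U (suc i) ⊆ B i
  U-suc⊆B i = Ufam-elim B U₀ Uₗ (_⊆ B i) (suc i) (λ ()) final inner
    where
      final : toℕ (suc i) ≡ suc b → Uₗ ⊆ B i
      final i≡b = subst (λ j → Uₗ ⊆ B j) (sym (toℕ≡n⇒≡fromℕ (suc-injective i≡b))) Uₗ⊆Bₗ
      inner : _ → _ → blk B (toℕ i) ∩ blk B (suc (toℕ i)) ⊆ B i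
      inner _ _ = subst (λ Z → blk B (toℕ i) ∩ blk B (suc (toℕ i)) ⊆ Z) (blk-toℕ B i) (p∩q⊆p _ _)

  U-last : U (fromℕ (suc b)) ≡ Uₗ
  U-last = Ufam-elim B U₀ Uₗ (_≡ Uₗ) (fromℕ (suc b)) (λ ()) (λ _ → refl)
             (λ _ last<b → ⊥-elim (<-irrefl (toℕ-fromℕ (suc b)) last<b))

-- The expanded design

data OldOrNew (v w : ℕ) : Fin (v + w) → Set where
  old : ∀ i → OldOrNew v w (i ↑ˡ w)
  new : ∀ j → OldOrNew v w (v ↑ʳ j)

old-or-new : ∀ v w (x : Fin (v + w)) → OldOrNew v w x
old-or-new v w x with splitAt v x in eq
... | inj₁ i = subst (OldOrNew v w) (splitAt⁻¹-↑ˡ eq) (old i)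
... | inj₂ j = subst (OldOrNew v w) (splitAt⁻¹-↑ʳ eq) (new j)

∈-↑ˡ : ∀ {v w i} {X : Subset v} (Y : Subset w) → i ∈ X → (i ↑ˡ w) ∈ (X ++ Y)
∈-↑ˡ {i = zero}  {_ ∷ X} Y here      = here
∈-↑ˡ {i = suc i} {_ ∷ X} Y (there h) = there (∈-↑ˡ Y h)

∈-↑ʳ : ∀ {v w j} (X : Subset v) {Y : Subset w} → j ∈ Y → (v ↑ʳ j) ∈ (X ++ Y)
∈-↑ʳ []      h = h
∈-↑ʳ (_ ∷ X) h = there (∈-↑ʳ X h)

module Construction (n K : ℕ) .{{_ : NonZero K}} where
  open RoundRobin n public

  Block : Set
  Block = Subset (M * K + suc M)

  oldBlock : Subset (M * K) → Block
  oldBlock X = X ++ ⊥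

  inserted : Bool → Subset (M * K) → ℕ → List Block
  inserted true  U r = map (U ++_) (factor r)
  inserted false U r = []

  All-inserted : ∀ {P : Block → Set} s U r → (∀ {e} → ∣ e ∣ ≡ 2 → P (U ++ e)) → All P (inserted s U r)
  All-inserted true  U r P-U++ = All.map⁺ (All.map P-U++ (All-factor-pairs r))
  All-inserted false U r P-U++ = []

  Linked-inserted : ∀ s U r → Linked DoubleChange (inserted s U r)
  Linked-inserted true  U r = Linked.map⁺ (Linked.map (DoubleChange-++ˡ {U = U}) (Linked-factor r))
  Linked-inserted false U r = []

  module Expand {b} {B : Blocks (M * K) (suc b)} (D : IsDCCD (M * K) (suc (suc K)) (suc b) B)
                {U₀ Uₗ : Subset (M * K)} (U₀⊆B₀ : U₀ ⊆ B zero) (Uₗ⊆Bₗ : Uₗ ⊆ B (fromℕ b))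
                (∣U₀∣ : ∣ U₀ ∣ ≡ K) (∣Uₗ∣ : ∣ Uₗ ∣ ≡ K)
                (S : Subset (suc (suc b))) (partition : PartitionedBy (Ufam B U₀ Uₗ) S) where
    open IsDCCD D
    open Unchanged D U₀⊆B₀ Uₗ⊆Bₗ ∣U₀∣ ∣Uₗ∣ public

    skeleton : Fin (suc b) → Block
    skeleton i = oldBlock (B i)

    run : Fin (suc (suc b)) → List Block
    run p = inserted (Vec.lookup S p) (U p) (rank S p)

    expanded : List Block
    expanded = weave (suc b) run skeleton

    ∣S∣≡M : ∣ S ∣ ≡ M
    ∣S∣≡M = *-cancelʳ-≡ ∣ S ∣ M K (begin
      ∣ S ∣ * K     ≡⟨ ∣⋃∣≡∣S∣*K S U (λ {x} {p} {q} → proj₂ partition x p q) (λ {p} _ → ∣U∣≡K p) ⟨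
      ∣ ⋃[ S ] U ∣  ≡⟨ ∀∈⇒∣p∣≡n covered ⟩
      M * K         ∎)
      where
        open ≡-Reasoning
        covered : ∀ x → x ∈ ⋃[ S ] U
        covered x with proj₁ partition x
        ... | p , p∈S , x∈Up = ∈-⋃⁺ p∈S x∈Up

    run-length : ∀ p → p ∈ S → length (run p) ≡ suc n
    run-length p p∈S rewrite []=⇒lookup p∈S =
      trans (length-map (U p ++_) (factor (rank S p))) (length-applyUpTo (edge (rank S p)) (suc n))

    run-empty : ∀ p → p ∉ S → run p ≡ []
    run-empty p p∉S with Vec.lookup S p in eq
    ... | true  = ⊥-elim (p∉S (lookup⇒[]= p S eq))
    ... | false = refl

    ∈-run : ∀ {p e} → p ∈ S → e ∈ₗ factor (rank S p) → U p ++ e ∈ₗ run p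
    ∈-run {p} p∈S e∈ rewrite []=⇒lookup p∈S = ∈-map⁺ (U p ++_) e∈

    All-run : ∀ {P : Block → Set} p → (∀ {e} → ∣ e ∣ ≡ 2 → P (U p ++ e)) → All P (run p)
    All-run {P} p = All-inserted {P} (Vec.lookup S p) (U p) (rank S p)

    weavable : Weavable {R = DoubleChange} (suc b) run skeleton
    weavable = record
      { runs-linked     = λ p → Linked-inserted (Vec.lookup S p) (U p) (rank S p)
      ; run→skeleton    = λ i → All-run (inject₁ i) λ {e} ∣e∣ →
                            DoubleChange-sym {X = oldBlock (B i)} {U (inject₁ i) ++ e}
                              (DoubleChange-⊇ {Y = B i} {e = e} (U-inject₁⊆B i) (size i (inject₁ i)) ∣e∣)
      ; skeleton→run    = λ i → All-run (suc i) λ {e} ∣e∣ →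
                            DoubleChange-⊇ {Y = B i} {e = e} (U-suc⊆B i) (size i (suc i)) ∣e∣
      ; skeleton-linked = λ i j i→j → DoubleChange-++⊥ {X = B i} {B j} (change i j i→j)
      }
      where
        size : ∀ i p → ∣ B i ∣ ≡ 2 + ∣ U p ∣
        size i p = trans (blockSize i) (cong (2 +_) (sym (∣U∣≡K p)))

    Linked-expanded : Linked DoubleChange expanded
    Linked-expanded = Linked-weave (suc b) {run} {skeleton} weavable

    All-expanded-size : All (λ X → ∣ X ∣ ≡ suc (suc K)) expanded
    All-expanded-size = All-weave (suc b) {run} {skeleton} (λ p → All-run p (inserted-size p)) old-size
      where
        inserted-size : ∀ p {e} → ∣ e ∣ ≡ 2 → ∣ U p ++ e ∣ ≡ suc (suc K)
        inserted-size p {e} ∣e∣ =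
          trans (∣p++q∣≡∣p∣+∣q∣ (U p) e) (trans (cong₂ _+_ (∣U∣≡K p) ∣e∣) (+-comm K 2))
        old-size : ∀ i → ∣ skeleton i ∣ ≡ suc (suc K)
        old-size i =
          trans (∣p++q∣≡∣p∣+∣q∣ (B i) ⊥) (trans (cong₂ _+_ (blockSize i) (∣⊥∣≡0 (suc M))) (+-identityʳ _))

    length-expanded : length expanded ≡ suc b + M * suc n
    length-expanded = trans (length-weave (suc b) {run} {skeleton} S run-length run-empty)
                            (cong (λ s → suc b + s * suc n) ∣S∣≡M)

    covers-old-new : ∀ i j → ∃ λ X → X ∈ₗ expanded × (i ↑ˡ suc M) ∈ X × (M * K ↑ʳ j) ∈ X
    covers-old-new i j with proj₁ partition i
    ... | p , p∈S , i∈Up with edge-through-point (rank S p) j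
    ...   | t , t≤n , j∈e =
      U p ++ edge (rank S p) t , ∈-weave-run (suc b) {run} {skeleton} p (∈-run p∈S (∈-factor t≤n)) ,
      ∈-↑ˡ _ i∈Up , ∈-↑ʳ (U p) j∈e

    covers : Covers expanded
    covers x y x≢y with old-or-new (M * K) (suc M) x | old-or-new (M * K) (suc M) y
    ... | old i | old i′ with covering i i′ (λ i≡i′ → x≢y (cong (_↑ˡ suc M) i≡i′))
    ...   | c , i∈ , i′∈ = skeleton c , ∈-weave-skeleton (suc b) {run} {skeleton} c , ∈-↑ˡ ⊥ i∈ , ∈-↑ˡ ⊥ i′∈
    covers x y x≢y | old i | new j = covers-old-new i j
    covers x y x≢y | new j | old i with covers-old-new i j
    ...   | X , X∈ , i∈X , j∈X = X , X∈ , j∈X , i∈X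
    covers x y x≢y | new j | new j′ with edge-through-pair j j′ (λ j≡j′ → x≢y (cong (M * K ↑ʳ_) j≡j′))
    ...   | r , r<M , t , t≤n , j∈e , j′∈e with rank-surjective S (subst (r <_) (sym ∣S∣≡M) r<M)
    ...     | p , p∈S , refl =
      U p ++ edge (rank S p) t , ∈-weave-run (suc b) {run} {skeleton} p (∈-run p∈S (∈-factor t≤n)) ,
      ∈-↑ʳ (U p) j∈e , ∈-↑ʳ (U p) j′∈e

    module Closed (U₀⊆Bₗ : U₀ ⊆ B (fromℕ b)) (Uₗ⊆B₀ : Uₗ ⊆ B zero)
                  (closing : DoubleChange (B (fromℕ b)) (B zero))
                  (not-both : ¬ (zero ∈ S × fromℕ (suc b) ∈ S)) where

      ends-empty : run zero ≡ [] ⊎ run (fromℕ (suc b)) ≡ []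
      ends-empty with Vec.lookup S zero in s₀ | Vec.lookup S (fromℕ (suc b)) in sₗ
      ... | false | _     = inj₁ refl
      ... | true  | false = inj₂ refl
      ... | true  | true  = ⊥-elim (not-both (lookup⇒[]= zero S s₀ , lookup⇒[]= (fromℕ (suc b)) S sₗ))

      Connected-expanded : Connected DoubleChange (last expanded) (head expanded)
      Connected-expanded = Connected-last-head-weave b {run} {skeleton} weavable ends-empty
        (All-run zero λ {e} ∣e∣ →
           DoubleChange-⊇ {Y = B (fromℕ b)} {e = e} U₀⊆Bₗ (size (fromℕ b) {U₀} ∣U₀∣) ∣e∣)
        (All-run (fromℕ (suc b)) λ {e} ∣e∣ → DoubleChange-sym {X = oldBlock (B zero)} {U (fromℕ (suc b)) ++ e}
           (DoubleChange-⊇ {Y = B zero} {e = e} (subst (_⊆ B zero) (sym U-last) Uₗ⊆B₀)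
              (size zero {U (fromℕ (suc b))} (trans (cong ∣_∣ U-last) ∣Uₗ∣)) ∣e∣))
        (DoubleChange-++⊥ {X = B (fromℕ b)} {B zero} closing)
        where
          size : ∀ i {X} → ∣ X ∣ ≡ K → ∣ B i ∣ ≡ 2 + ∣ X ∣
          size i ∣X∣ = trans (blockSize i) (cong (2 +_) (sym ∣X∣))

  expand-linear : ∀ {b} (B : Blocks (M * K) b) → IsDCCD (M * K) (suc (suc K)) b B →
                  HasExpansionSet (M * K) (suc (suc K)) b B →
                  Σ (Blocks (M * K + suc M) (b + M * suc n)) (IsDCCD (M * K + suc M) (suc (suc K)) (b + M * suc n))
  expand-linear {suc b} B D (U₀ , Uₗ , (f , f≡0 , U₀⊆Bf , ∣U₀∣) , (l , l≡b , Uₗ⊆Bl , ∣Uₗ∣) , S , partition)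
    with toℕ≡0⇒≡zero f≡0 | toℕ≡n⇒≡fromℕ (suc-injective l≡b)
  ... | refl | refl = subst (λ c → Σ (Blocks _ c) (IsDCCD _ _ c)) length-expanded
                        (lookup expanded , IsDCCD-lookup expanded Linked-expanded All-expanded-size covers)
    where open Expand D U₀⊆Bf Uₗ⊆Bl ∣U₀∣ ∣Uₗ∣ S partition

  expand-circular : ∀ {b} (B : Blocks (M * K) b) → IsCDCCD (M * K) (suc (suc K)) b B →
                    HasCircExpansionSet (M * K) (suc (suc K)) b B →
                    Σ (Blocks (M * K + suc M) (b + M * suc n)) (IsCDCCD (M * K + suc M) (suc (suc K)) (b + M * suc n))
  expand-circular {suc b} B C (f , l , f≡0 , l≡b , S , partition)
    with toℕ≡0⇒≡zero f≡0 | toℕ≡n⇒≡fromℕ (suc-injective l≡b)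
  ... | refl | refl = subst (λ c → Σ (Blocks _ c) (IsCDCCD _ _ c)) length-expanded
                        (lookup expanded ,
                         IsCDCCD-lookup expanded Linked-expanded All-expanded-size covers Connected-expanded)
    where
      open IsCDCCD C
      Z = B zero ∩ B (fromℕ b)
      closing : DoubleChange (B (fromℕ b)) (B zero)
      closing = circular zero (fromℕ b) refl (cong suc (toℕ-fromℕ b))
      ∣Z∣ : ∣ Z ∣ ≡ K
      ∣Z∣ = DoubleChange⇒∣∩∣ {X = B zero} {B (fromℕ b)} (IsDCCD.blockSize isDCCD zero)
              (DoubleChange-sym {X = B (fromℕ b)} closing)
      open Expand isDCCD (p∩q⊆p _ _) (p∩q⊆q _ _) ∣Z∣ ∣Z∣ S partition
      not-both : ¬ (zero ∈ S × fromℕ (suc b) ∈ S)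
      not-both (first∈S , last∈S) with ∣p∣≢0⇒Nonempty {p = Z} (λ ∣Z∣≡0 → ≢-nonZero⁻¹ K (trans (sym ∣Z∣) ∣Z∣≡0))
      ... | x , x∈Z with proj₂ partition x zero (fromℕ (suc b)) first∈S last∈S x∈Z
                           (subst (x ∈_) (sym U-last) x∈Z)
      ...   | ()
      open Closed (p∩q⊆q _ _) (p∩q⊆p _ _) closing not-both

odd⇒1+n+n : ∀ {m} → m % 2 ≡ 1 → ∃ λ n → m ≡ suc (n + n)
odd⇒1+n+n {m} m%2≡1 = m / 2 , (begin
  m                   ≡⟨ m≡m%n+[m/n]*n m 2 ⟩
  m % 2 + m / 2 * 2   ≡⟨ cong₂ _+_ m%2≡1 (*-comm (m / 2) 2) ⟩
  suc (m / 2 + (m / 2 + 0)) ≡⟨ cong (λ h → suc (m / 2 + h)) (+-identityʳ (m / 2)) ⟩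
  suc (m / 2 + m / 2) ∎)
  where open ≡-Reasoning

kC2≤vC2 : ∀ {v k b} {B : Blocks v b} → IsDCCD v k b B → Fin b → k C 2 ≤ v C 2
kC2≤vC2 {B = B} D i = C2-mono-≤ (subst (_≤ _) (IsDCCD.blockSize D i) (∣p∣≤n (B i)))

mainTheorem2 : ∀ (k v b m : ℕ) → 3 ≤ k → v ≡ m * (k ∸ 2) → m % 2 ≡ 1 →
    (B : Blocks v b) →
    ((IsDCCD v k b B → HasExpansionSet v k b B →
      Σ (Blocks (v + m + 1) (b + m * ((m + 1) / 2))) λ B* →
        IsDCCD (v + m + 1) k (b + m * ((m + 1) / 2)) B* ×
        (EconomicalLin v k b → EconomicalLin (v + m + 1) k (b + m * ((m + 1) / 2))) ×
        (TightLin v k b → TightLin (v + m + 1) k (b + m * ((m + 1) / 2))))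
    ×
     (IsCDCCD v k b B → HasCircExpansionSet v k b B →
      Σ (Blocks (v + m + 1) (b + m * ((m + 1) / 2))) λ B* →
        IsCDCCD (v + m + 1) k (b + m * ((m + 1) / 2)) B* ×
        (EconomicalCirc v k b → EconomicalCirc (v + m + 1) k (b + m * ((m + 1) / 2))) ×
        (TightCirc v k b → TightCirc (v + m + 1) k (b + m * ((m + 1) / 2))) ×
        (EconomicalLin v k b → EconomicalLin (v + m + 1) k (b + m * ((m + 1) / 2))) ×
        (TightLin v k b → TightLin (v + m + 1) k (b + m * ((m + 1) / 2)))))
mainTheorem2 (suc (suc (suc K′))) v b m (s≤s (s≤s (s≤s z≤n))) refl m-odd B with odd⇒1+n+n {m} m-odd
... | n , refl =
    (λ D E@(_ , _ , (f , _) , _) →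
       map₂ (_, EconomicalLin-grow (kC2≤vC2 D f) , TightLin-grow (kC2≤vC2 D f))
            (subst₂ (λ N c → Σ (Blocks N c) (IsDCCD N k c)) points blocks (expand-linear B D E)))
  , (λ CD E@(f , _) →
       map₂ (_, EconomicalCirc-grow , TightCirc-grow ,
                EconomicalLin-grow (kC2≤vC2 (IsCDCCD.isDCCD CD) f) , TightLin-grow (kC2≤vC2 (IsCDCCD.isDCCD CD) f))
            (subst₂ (λ N c → Σ (Blocks N c) (IsCDCCD N k c)) points blocks (expand-circular B CD E)))
  where
    open Construction n (suc K′)
    k = suc (suc (suc K′))
    open Growth (M * suc K′) (M * suc K′ + M + 1) k (M * ((M + 1) / 2))
                (C2-growth n (suc K′)) (subst (0 <_) (sym (2*[2+K]∸3≡1+K+K (suc K′))) (s≤s z≤n))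
    points : M * suc K′ + suc M ≡ M * suc K′ + M + 1
    points = trans (+-suc (M * suc K′) M) (+-comm 1 (M * suc K′ + M))
    blocks : b + M * suc n ≡ b + M * ((M + 1) / 2)
    blocks = cong (λ h → b + M * h) (sym ([m+1]/2≡1+n n))
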